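{- For $n\geq 1$ let $\mu(n)$ denote the degree of the variant $\mathcal T_n^a$ where $a\in\mathcal T_n$ has rank $1$. For any real number $1<x<2$ there exists $N\in\mathbb N$ such that $\mu(n)\leq xn$ for all $n>N$. Consequently $\mu(n)\sim n$ as $n\to\infty$.
   Context: $\mathcal T_n$ is the full transformation semigroup on $\{1,\dots,n\}$; the rank of a transformation is the size of its image. The variant $\mathcal T_n^a$ is the set $\mathcal T_n$ with operation $f\star g=fag$. The degree of a finite semigroup $S$ is the least $m\geq1$ such that $S$ embeds in $\mathcal T_m$. The degree of $\mathcal T_n^a$ does not depend on the choice of the rank-$1$ map $a$.
   Formalization: The number x ranges over rationals with $1<x<2$ rather than real numbers, and $\mu(n)\sim n$ is expressed through rational tolerances. -}

module Defs where

open import Data.Nat as ℕ using (ℕ; suc)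
open import Data.Fin using (Fin)
open import Data.Fin.Properties using (any?; _≟_)
open import Data.Fin.Subset using (Subset; ∣_∣)
open import Data.Vec using (tabulate)
open import Data.Product using (_×_)
open import Data.Integer using (+_)
open import Data.Rational as ℚ using (ℚ; _/_)
open import Relation.Nullary using (¬_; does)
open import Relation.Binary.PropositionalEquality using (_≡_)

Trans : ℕ → Set
Trans n = Fin n → Fin n

_≈_ : ∀ {n} → Trans n → Trans n → Set
f ≈ g = ∀ i → f i ≡ g i

-- Product in 𝒯ₙ, maps acting on the right: x (f g) = (x f) g.
_⨾_ : ∀ {n} → Trans n → Trans n → Trans n
(f ⨾ g) i = g (f i)

image : ∀ {n} → Trans n → Subset n
image {n} f = tabulate (λ j → does (any? (λ i → f i ≟ j)))

rank : ∀ {n} → Trans n → ℕ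
rank f = ∣ image f ∣

variantProd : ∀ {n} → Trans n → Trans n → Trans n → Trans n
variantProd a f g = f ⨾ (a ⨾ g)

record Embedding (n : ℕ) (a : Trans n) (m : ℕ) : Set where
  field
    φ     : Trans n → Trans m
    φ-cong : ∀ {f g} → f ≈ g → φ f ≈ φ g
    φ-inj  : ∀ {f g} → φ f ≈ φ g → f ≈ g
    φ-hom  : ∀ f g → φ (variantProd a f g) ≈ (φ f ⨾ φ g)

IsDegree : (n : ℕ) → Trans n → ℕ → Set
IsDegree n a d =
  1 ℕ.≤ d × Embedding n a d × (∀ k → 1 ℕ.≤ k → k ℕ.< d → ¬ Embedding n a k)

ℕ→ℚ : ℕ → ℚ
ℕ→ℚ k = (+ k) / 1

-- If a has rank 1, with image {c}, then every product f ⋆ g = f a g is the constant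
-- map with value g c.  Hence 𝒯ₙᵃ acts faithfully on a set of size roughly n: a block
-- of s points on which a non-constant y writes a code of itself (as a word of length s
-- over t letters, possible once nⁿ ≤ tˢ) and which every constant map collapses, an
-- absorbing block of t + 1 points receiving those codes, and two blocks of r points on
-- which y writes the two base-r digits of y c.  Choosing t = r ≈ n / 9K and
-- s ≈ n + n / 3K gives μ(n) ≤ (1 + 1/K) n for large n.  Conversely an embedding into
-- 𝒯ₘ forces nⁿ ≤ mᵐ, so μ(n) ≥ n.  Since embeddability into 𝒯ₘ is decidable, the
-- least such m exists constructively.
module Submission where

open import Defs
open import Data.Nat as ℕ
  using (ℕ; zero; suc; z≤n; s≤s; _≤_; _<_; _+_; _*_; _^_; _/_; _%_; NonZero)
import Data.Nat.Properties as ℕₚ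
import Data.Nat.DivMod as ℕₚ
open import Data.Nat.Tactic.RingSolver using (solve-∀)
import Data.Nat.Coprimality as Coprime
open import Algebra.Properties.CommutativeSemigroup ℕₚ.*-commutativeSemigroup
  using () renaming (interchange to *-interchange)
open import Data.Fin
  using (Fin; zero; suc; funToFin; finToFun; inject≤; remQuot; combine; fromℕ<)
open import Data.Fin.Properties
  using (_≟_; any?; all?; finToFun-funToFin; funToFin-finToFin; inject≤-injective;
         combine-remQuot; injective⇒≤; +↔⊎; suc-injective)
open import Data.Fin.Subset using (_∈_; ⁅_⁆; _⊂_)
import Data.Fin.Subset.Properties as Subsetₚ
import Data.Vec.Properties as Vecₚ
open import Data.Integer as ℤ using (+_; -[1+_])
import Data.Integer.Properties as ℤₚ
open import Data.Rational as ℚ using (ℚ; mkℚ; 0ℚ; 1ℚ; _-_)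
import Data.Rational.Properties as ℚₚ
import Data.Rational.Unnormalised as ℚᵘ
import Data.Rational.Unnormalised.Properties as ℚᵘₚ
open import Data.Product using (_×_; ∃; ∃-syntax; ∃₂; _,_; proj₁; proj₂; uncurry)
open import Data.Sum using (_⊎_; inj₁; inj₂)
open import Data.Sum.Properties using (inj₁-injective; inj₂-injective)
open import Data.Sum.Function.Propositional using (_⊎-↔_)
open import Level using (Level)
open import Function using (_∘_; _↔_; Inverse)
open import Function.Properties.Inverse using (↔-refl; ↔-trans)
open import Relation.Nullary using (¬_; Dec; yes; no; _×-dec_; _→-dec_; contradiction)
import Relation.Nullary.Decidable as Dec
open import Relation.Unary using (Pred; Decidable)
open import Relation.Binary.PropositionalEquality

private
  variable
    m n k : ℕ
    ℓ : Level

funToFin-cong : {f g : Fin m → Fin n} → (∀ i → f i ≡ g i) → funToFin f ≡ funToFin g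
funToFin-cong {zero}  eq = refl
funToFin-cong {suc m} eq = cong₂ combine (eq zero) (funToFin-cong (eq ∘ suc))

funToFin-injective : {f g : Fin m → Fin n} → funToFin f ≡ funToFin g → ∀ i → f i ≡ g i
funToFin-injective {f = f} {g} eq i = begin
  f i                         ≡⟨ finToFun-funToFin f i ⟨
  finToFun (funToFin f) i     ≡⟨ cong (λ w → finToFun w i) eq ⟩
  finToFun (funToFin g) i     ≡⟨ finToFun-funToFin g i ⟩
  g i                         ∎
  where open ≡-Reasoning

finToFun-injective : {i j : Fin (n ^ m)} →
                     (∀ x → finToFun {n} {m} i x ≡ finToFun j x) → i ≡ j
finToFun-injective {n = n} {m = m} {i = i} {j = j} eq = begin
  i                             ≡⟨ funToFin-finToFin {m} {n} i ⟨
  funToFin (finToFun {n} {m} i) ≡⟨ funToFin-cong eq ⟩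
  funToFin (finToFun {n} {m} j) ≡⟨ funToFin-finToFin {m} {n} j ⟩
  j                             ∎
  where open ≡-Reasoning

any-function? : {P : Pred (Fin m → Fin n) ℓ} → (∀ {f g} → (∀ i → f i ≡ g i) → P f → P g) →
                Decidable P → Dec (∃ P)
any-function? {m} {n} resp P? =
  Dec.map′ (λ (i , p) → finToFun {n} i , p)
           (λ (f , p) → funToFin f , resp (sym ∘ finToFun-funToFin f) p)
           (any? (P? ∘ finToFun {n}))

⨾-cong : {f f′ g g′ : Trans n} → f ≈ f′ → g ≈ g′ → (f ⨾ g) ≈ (f′ ⨾ g′)
⨾-cong {g = g} f≈f′ g≈g′ i = trans (cong g (f≈f′ i)) (g≈g′ _)

variantProd-cong : (a : Trans n) {f f′ g g′ : Trans n} → f ≈ f′ → g ≈ g′ →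
                   variantProd a f g ≈ variantProd a f′ g′
variantProd-cong a f≈f′ g≈g′ = ⨾-cong f≈f′ (⨾-cong {f = a} (λ _ → refl) g≈g′)

inImage : (a : Trans n) (i : Fin n) → a i ∈ image a
inImage a i = Vecₚ.lookup⇒[]= (a i) (image a)
  (trans (Vecₚ.lookup∘tabulate _ (a i)) (Dec.dec-true (any? (λ x → a x ≟ a i)) (i , refl)))

rank≡1⇒constant : (a : Trans n) → rank a ≡ 1 → ∀ i j → a i ≡ a j
rank≡1⇒constant a rank≡1 i j with a i ≟ a j
... | yes ai≡aj = ai≡aj
... | no ai≢aj  = contradiction
  (subst₂ _<_ (Subsetₚ.∣⁅x⁆∣≡1 (a i)) rank≡1 (Subsetₚ.p⊂q⇒∣p∣<∣q∣ ⁅ai⁆⊂image)) (ℕₚ.<-irrefl refl)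
  where
  ⁅ai⁆⊂image : ⁅ a i ⁆ ⊂ image a
  ⁅ai⁆⊂image = (λ x∈ → subst (_∈ image a) (sym (Subsetₚ.x∈⁅y⁆⇒x≡y (a i) x∈)) (inImage a i))
             , a j , inImage a j , ai≢aj ∘ sym ∘ Subsetₚ.x∈⁅y⁆⇒x≡y (a i)

-- Embeddings as finite objects

module Coded {n : ℕ} (a : Trans n) (k : ℕ) where

  _⋆_ : Fin (n ^ n) → Fin (n ^ n) → Fin (n ^ n)
  i ⋆ j = funToFin (variantProd a (finToFun {n} i) (finToFun {n} j))

  _∙_ : Fin (k ^ k) → Fin (k ^ k) → Fin (k ^ k)
  i ∙ j = funToFin (finToFun {k} i ⨾ finToFun {k} j)

  IsCodedEmbedding : (Fin (n ^ n) → Fin (k ^ k)) → Set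
  IsCodedEmbedding Φ = (∀ i j → Φ i ≡ Φ j → i ≡ j) × (∀ i j → Φ (i ⋆ j) ≡ Φ i ∙ Φ j)

  isCodedEmbedding? : Decidable IsCodedEmbedding
  isCodedEmbedding? Φ =
    all? (λ i → all? (λ j → (Φ i ≟ Φ j) →-dec (i ≟ j)))
    ×-dec all? (λ i → all? (λ j → Φ (i ⋆ j) ≟ Φ i ∙ Φ j))

  IsCodedEmbedding-resp : ∀ {Φ Ψ} → (∀ i → Φ i ≡ Ψ i) → IsCodedEmbedding Φ → IsCodedEmbedding Ψ
  IsCodedEmbedding-resp {Φ} {Ψ} Φ≗Ψ (injective , homo) =
    (λ i j Ψi≡Ψj → injective i j (trans (Φ≗Ψ i) (trans Ψi≡Ψj (sym (Φ≗Ψ j))))) ,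
    (λ i j → trans (sym (Φ≗Ψ (i ⋆ j))) (trans (homo i j) (cong₂ _∙_ (Φ≗Ψ i) (Φ≗Ψ j))))

  embedding⇒coded : Embedding n a k → ∃ IsCodedEmbedding
  embedding⇒coded e = Φ , injective , homo
    where
    open Embedding e
    open ≡-Reasoning
    Φ : Fin (n ^ n) → Fin (k ^ k)
    Φ i = funToFin (φ (finToFun {n} i))
    injective : ∀ i j → Φ i ≡ Φ j → i ≡ j
    injective i j = finToFun-injective ∘ φ-inj ∘ funToFin-injective
    homo : ∀ i j → Φ (i ⋆ j) ≡ Φ i ∙ Φ j
    homo i j = funToFin-cong λ x → begin
      φ (finToFun {n} (i ⋆ j)) x                        ≡⟨ φ-cong (finToFun-funToFin _) x ⟩
      φ (variantProd a (finToFun {n} i) (finToFun j)) x  ≡⟨ φ-hom _ _ x ⟩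
      (φ (finToFun {n} i) ⨾ φ (finToFun j)) x            ≡⟨ ⨾-cong (sym ∘ finToFun-funToFin _)
                                                                  (sym ∘ finToFun-funToFin _) x ⟩
      (finToFun {k} (Φ i) ⨾ finToFun (Φ j)) x            ∎

  coded⇒embedding : ∃ IsCodedEmbedding → Embedding n a k
  coded⇒embedding (Φ , injective , homo) = record
    { φ      = φ
    ; φ-cong = λ f≈g x → cong (λ w → finToFun {k} (Φ w) x) (funToFin-cong f≈g)
    ; φ-inj  = λ φf≈φg → funToFin-injective (injective _ _ (finToFun-injective φf≈φg))
    ; φ-hom  = λ f g x → begin
        φ (variantProd a f g) x                  ≡⟨ cong (λ w → finToFun {k} (Φ w) x) (funToFin-cong
                                                      (variantProd-cong a (sym ∘ finToFun-funToFin f)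
                                                                          (sym ∘ finToFun-funToFin g))) ⟩
        finToFun {k} (Φ (funToFin f ⋆ funToFin g)) x ≡⟨ cong (λ w → finToFun {k} w x) (homo _ _) ⟩
        finToFun {k} (funToFin (φ f ⨾ φ g)) x    ≡⟨ finToFun-funToFin (φ f ⨾ φ g) x ⟩
        (φ f ⨾ φ g) x                            ∎
    }
    where
    open ≡-Reasoning
    φ : Trans n → Trans k
    φ f = finToFun {k} (Φ (funToFin f))

embedding? : (a : Trans n) (k : ℕ) → Dec (Embedding n a k)
embedding? a k = Dec.map′ coded⇒embedding embedding⇒coded
                          (any-function? IsCodedEmbedding-resp isCodedEmbedding?)
  where open Coded a k

embedding⇒^≤^ : {a : Trans n} → Embedding n a k → n ^ n ≤ k ^ k
embedding⇒^≤^ {k = k} {a = a} e with Coded.embedding⇒coded a k e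
... | Φ , injective , _ = injective⇒≤ {f = Φ} (injective _ _)

m<n⇒m^m<n^n : 1 ≤ m → m < n → m ^ m < n ^ n
m<n⇒m^m<n^n {m} {n} 1≤m m<n = begin-strict
  m ^ m   ≤⟨ ℕₚ.^-monoʳ-≤ m {{ℕ.>-nonZero 1≤m}} (ℕₚ.<⇒≤ m<n) ⟩
  m ^ n   <⟨ ℕₚ.^-monoˡ-< n {{ℕ.>-nonZero (ℕₚ.≤-trans 1≤m (ℕₚ.<⇒≤ m<n))}} m<n ⟩
  n ^ n   ∎
  where open ℕₚ.≤-Reasoning

n^n≤m^m⇒n≤m : 1 ≤ m → n ^ n ≤ m ^ m → n ≤ m
n^n≤m^m⇒n≤m {m} {n} 1≤m nⁿ≤mᵐ with n ℕ.≤? m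
... | yes n≤m = n≤m
... | no  n≰m = contradiction nⁿ≤mᵐ (ℕₚ.<⇒≱ (m<n⇒m^m<n^n 1≤m (ℕₚ.≰⇒> n≰m)))

module _ {P : Pred ℕ ℓ} (P? : Decidable P) where

  least-below : ∀ m → (∀ k → k < m → ¬ P k) ⊎ ∃[ d ] d < m × P d × (∀ k → k < d → ¬ P k)
  least-below zero = inj₁ (λ _ ())
  least-below (suc m) with least-below m
  ... | inj₂ (d , d<m , Pd , below-d) = inj₂ (d , ℕₚ.m≤n⇒m≤1+n d<m , Pd , below-d)
  ... | inj₁ none-below with P? m
  ...   | yes Pm = inj₂ (m , ℕₚ.≤-refl , Pm , none-below)
  ...   | no ¬Pm = inj₁ λ k k<1+m → case (ℕₚ.m≤n⇒m<n∨m≡n (ℕₚ.≤-pred k<1+m))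
    where
    case : ∀ {k} → k < m ⊎ k ≡ m → ¬ P k
    case (inj₁ k<m)  = none-below _ k<m
    case (inj₂ refl) = ¬Pm

  least-witness : P m → ∃[ d ] d ≤ m × P d × (∀ k → k < d → ¬ P k)
  least-witness {m} Pm with least-below (suc m)
  ... | inj₁ none-below                = contradiction Pm (none-below m ℕₚ.≤-refl)
  ... | inj₂ (d , d<1+m , Pd , below-d) = d , ℕₚ.≤-pred d<1+m , Pd , below-d

degree-between : {a : Trans n} → 1 ≤ m → Embedding n a m → ∃[ d ] IsDegree n a d × n ≤ d × d ≤ m
degree-between {n} {m} {a} 1≤m e
  with least-witness (λ k → (1 ℕ.≤? k) ×-dec embedding? a k) (1≤m , e)
... | d , d≤m , (1≤d , e′) , below-d =
  d , (1≤d , e′ , λ k 1≤k k<d e″ → below-d k k<d (1≤k , e″)) ,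
  n^n≤m^m⇒n≤m 1≤d (embedding⇒^≤^ e′) , d≤m

-- A faithful action of 𝒯ₙᵃ when a is constant

record FaithfulAction {n : ℕ} (a : Trans n) (Ω : Set) : Set where
  field
    act           : Trans n → Ω → Ω
    act-cong      : ∀ {f g} → f ≈ g → ∀ ω → act f ω ≡ act g ω
    act-injective : ∀ {f g} → (∀ ω → act f ω ≡ act g ω) → f ≈ g
    act-hom       : ∀ f g ω → act (variantProd a f g) ω ≡ act g (act f ω)

faithfulAction⇒embedding : {a : Trans n} {Ω : Set} → Fin m ↔ Ω → FaithfulAction a Ω → Embedding n a m
faithfulAction⇒embedding {n} {m} {a} I A = record
  { φ      = φ
  ; φ-cong = λ f≈g i → cong from (act-cong f≈g (to i))
  ; φ-inj  = λ {f} {g} φf≈φg → act-injective λ ω → begin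
      act f ω                     ≡⟨ cong (act f) (strictlyInverseˡ ω) ⟨
      act f (to (from ω))         ≡⟨ strictlyInverseˡ _ ⟨
      to (φ f (from ω))           ≡⟨ cong to (φf≈φg (from ω)) ⟩
      to (φ g (from ω))           ≡⟨ strictlyInverseˡ _ ⟩
      act g (to (from ω))         ≡⟨ cong (act g) (strictlyInverseˡ ω) ⟩
      act g ω                     ∎
  ; φ-hom  = λ f g i → begin
      from (act (variantProd a f g) (to i)) ≡⟨ cong from (act-hom f g (to i)) ⟩
      from (act g (act f (to i)))           ≡⟨ cong (from ∘ act g) (strictlyInverseˡ _) ⟨
      from (act g (to (φ f i)))             ∎
  }
  where
  open Inverse I
  open FaithfulAction A
  open ≡-Reasoning
  φ : Trans n → Trans m
  φ f i = from (act f (to i))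

module ConstantVariant {n : ℕ} (a : Trans n) (c : Fin n) (a≡c : ∀ i → a i ≡ c)
  {s t r : ℕ} (0<s : 0 < s) (nⁿ≤tˢ : n ^ n ≤ t ^ s) (n≤r² : n ≤ r * r) where

  Points : Set
  Points = Fin s ⊎ Fin (suc t) ⊎ Fin r ⊎ Fin r

  word : Trans n → Fin s → Fin t
  word y = finToFun (inject≤ (funToFin y) nⁿ≤tˢ)

  word-injective : ∀ {y y′} → (∀ z → word y z ≡ word y′ z) → y ≈ y′
  word-injective eq =
    funToFin-injective (inject≤-injective nⁿ≤tˢ nⁿ≤tˢ _ _ (finToFun-injective eq))

  digits : Fin n → Fin r × Fin r
  digits j = remQuot r (inject≤ j n≤r²)

  digits-injective : ∀ {j j′} → digits j ≡ digits j′ → j ≡ j′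
  digits-injective {j} {j′} eq = inject≤-injective n≤r² n≤r² j j′ (begin
    inject≤ j n≤r²                         ≡⟨ combine-remQuot {r} r _ ⟨
    uncurry combine (digits j)             ≡⟨ cong (uncurry combine) eq ⟩
    uncurry combine (digits j′)            ≡⟨ combine-remQuot {r} r _ ⟩
    inject≤ j′ n≤r²                        ∎)
    where open ≡-Reasoning

  IsConstant : Trans n → Set
  IsConstant y = ∀ i → y i ≡ y c

  isConstant? : Decidable IsConstant
  isConstant? y = all? (λ i → y i ≟ y c)

  IsConstant-resp : ∀ {y y′} → y ≈ y′ → IsConstant y → IsConstant y′
  IsConstant-resp y≈y′ const i = trans (sym (y≈y′ i)) (trans (const i) (y≈y′ c))

  variantProd-constant : ∀ f g → IsConstant (variantProd a f g)
  variantProd-constant f g i = cong g (trans (a≡c (f i)) (sym (a≡c (f c))))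

  word-cong : ∀ {y y′} → y ≈ y′ → ∀ z → word y z ≡ word y′ z
  word-cong y≈y′ z = cong (λ w → finToFun (inject≤ w nⁿ≤tˢ) z) (funToFin-cong y≈y′)

  flag : Trans n → Fin s → Fin (suc t)
  flag y z with isConstant? y
  ... | yes _ = zero
  ... | no  _ = suc (word y z)

  flag-constant : ∀ {y} → IsConstant y → ∀ z → flag y z ≡ zero
  flag-constant {y} const z with isConstant? y
  ... | yes _     = refl
  ... | no ¬const = contradiction const ¬const

  flag-nonconstant : ∀ {y} → ¬ IsConstant y → ∀ z → flag y z ≡ suc (word y z)
  flag-nonconstant {y} ¬const z with isConstant? y
  ... | yes const = contradiction const ¬const
  ... | no _      = refl

  act : Trans n → Points → Points
  act y (inj₁ z)                = inj₂ (inj₁ (flag y z))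
  act y (inj₂ (inj₁ _))         = inj₂ (inj₁ zero)
  act y (inj₂ (inj₂ (inj₁ _)))  = inj₂ (inj₂ (inj₁ (proj₁ (digits (y c)))))
  act y (inj₂ (inj₂ (inj₂ _)))  = inj₂ (inj₂ (inj₂ (proj₂ (digits (y c)))))

  flag-cong : ∀ {y y′} → y ≈ y′ → ∀ z → flag y z ≡ flag y′ z
  flag-cong {y} y≈y′ z with isConstant? y
  ... | yes const = sym (flag-constant (IsConstant-resp y≈y′ const) z)
  ... | no ¬const = trans (cong suc (word-cong y≈y′ z))
                          (sym (flag-nonconstant (¬const ∘ IsConstant-resp (sym ∘ y≈y′)) z))

  act-cong : ∀ {y y′} → y ≈ y′ → ∀ ω → act y ω ≡ act y′ ω
  act-cong y≈y′ (inj₁ z)               = cong (inj₂ ∘ inj₁) (flag-cong y≈y′ z)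
  act-cong y≈y′ (inj₂ (inj₁ _))        = refl
  act-cong y≈y′ (inj₂ (inj₂ (inj₁ _))) = cong (inj₂ ∘ inj₂ ∘ inj₁ ∘ proj₁ ∘ digits) (y≈y′ c)
  act-cong y≈y′ (inj₂ (inj₂ (inj₂ _))) = cong (inj₂ ∘ inj₂ ∘ inj₂ ∘ proj₂ ∘ digits) (y≈y′ c)

  act-injective : ∀ {y y′} → (∀ ω → act y ω ≡ act y′ ω) → y ≈ y′
  act-injective {y} {y′} eq = by-constancy (isConstant? y) (isConstant? y′)
    where
    z₀ : Fin s
    z₀ = fromℕ< 0<s

    b : Fin r
    b = proj₁ (digits c)

    flags : ∀ z → flag y z ≡ flag y′ z
    flags z = inj₁-injective (inj₂-injective (eq (inj₁ z)))

    yc≡y′c : y c ≡ y′ c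
    yc≡y′c = digits-injective (cong₂ _,_
      (inj₁-injective (inj₂-injective (inj₂-injective (eq (inj₂ (inj₂ (inj₁ b)))))))
      (inj₂-injective (inj₂-injective (inj₂-injective (eq (inj₂ (inj₂ (inj₂ b))))))))

    by-constancy : Dec (IsConstant y) → Dec (IsConstant y′) → y ≈ y′
    by-constancy (yes const) (yes const′) = λ i → trans (const i) (trans yc≡y′c (sym (const′ i)))
    by-constancy (yes const) (no ¬const′) = contradiction
      (trans (sym (flag-constant const z₀)) (trans (flags z₀) (flag-nonconstant ¬const′ z₀))) λ ()
    by-constancy (no ¬const) (yes const′) = contradiction
      (trans (sym (flag-nonconstant ¬const z₀)) (trans (flags z₀) (flag-constant const′ z₀))) λ ()
    by-constancy (no ¬const) (no ¬const′) = word-injective λ z → suc-injective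
      (trans (sym (flag-nonconstant ¬const z)) (trans (flags z) (flag-nonconstant ¬const′ z)))

  act-hom : ∀ f g ω → act (variantProd a f g) ω ≡ act g (act f ω)
  act-hom f g (inj₁ z)               = cong (inj₂ ∘ inj₁) (flag-constant (variantProd-constant f g) z)
  act-hom f g (inj₂ (inj₁ _))        = refl
  act-hom f g (inj₂ (inj₂ (inj₁ _))) = cong (inj₂ ∘ inj₂ ∘ inj₁ ∘ proj₁ ∘ digits ∘ g) (a≡c (f c))
  act-hom f g (inj₂ (inj₂ (inj₂ _))) = cong (inj₂ ∘ inj₂ ∘ inj₂ ∘ proj₂ ∘ digits ∘ g) (a≡c (f c))

  faithfulAction : FaithfulAction a Points
  faithfulAction = record
    { act = act ; act-cong = act-cong ; act-injective = act-injective ; act-hom = act-hom }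

  embedding : Embedding n a (s + (suc t + (r + r)))
  embedding = faithfulAction⇒embedding
    (↔-trans +↔⊎ (↔-refl ⊎-↔ ↔-trans +↔⊎ (↔-refl ⊎-↔ +↔⊎))) faithfulAction

-- Choice of the block sizes

^-distribʳ-* : ∀ m n o → (m * n) ^ o ≡ m ^ o * n ^ o
^-distribʳ-* m n zero    = refl
^-distribʳ-* m n (suc o) = begin
  m * n * (m * n) ^ o         ≡⟨ cong (m * n *_) (^-distribʳ-* m n o) ⟩
  m * n * (m ^ o * n ^ o)     ≡⟨ *-interchange m n (m ^ o) (n ^ o) ⟩
  m * m ^ o * (n * n ^ o)     ∎
  where open ≡-Reasoning

m<[1+m/n]*n : ∀ m n .{{_ : NonZero n}} → m < suc (m / n) * n
m<[1+m/n]*n m n = begin-strict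
  m                  ≡⟨ ℕₚ.m≡m%n+[m/n]*n m n ⟩
  m % n + m / n * n  <⟨ ℕₚ.+-monoˡ-< (m / n * n) (ℕₚ.m%n<n m n) ⟩
  suc (m / n) * n    ∎
  where open ℕₚ.≤-Reasoning

BlockSizes : ℕ → ℕ → Set
BlockSizes K n = ∃₂ λ s t →
  0 < s × n ^ n ≤ t ^ s × n ≤ t * t × K * (s + (suc t + (t + t))) ≤ (K + 1) * n

blockSizes : ∀ K .{{_ : NonZero K}} → ∃[ N ] ∀ n → N < n → BlockSizes K n
blockSizes K = N , λ n N<n →
  n + p n , t n , ℕₚ.≤-trans (s≤s z≤n) (ℕₚ.m≤n+m (p n) n) , nⁿ≤tˢ n N<n , n≤t² n N<n , size n N<n
  where
  open ℕₚ.≤-Reasoning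
  L M N : ℕ
  L = 3 * K
  M = 9 * K
  N = M ^ suc L + 15 * K
  instance
    _ : NonZero L
    _ = ℕₚ.m*n≢0 3 K
    _ : NonZero M
    _ = ℕₚ.m*n≢0 9 K

  t p : ℕ → ℕ
  t n = suc (n / M)
  p n = suc (n / L)

  Mᴸ<t : ∀ n → N < n → M ^ L < t n
  Mᴸ<t n N<n = s≤s (begin
    M ^ L             ≡⟨ ℕₚ.m*n/n≡m (M ^ L) M ⟨
    M ^ L * M / M     ≤⟨ ℕₚ./-monoˡ-≤ M (begin
                           M ^ L * M  ≡⟨ ℕₚ.*-comm (M ^ L) M ⟩
                           M ^ suc L  ≤⟨ ℕₚ.m≤m+n _ _ ⟩
                           N          ≤⟨ ℕₚ.<⇒≤ N<n ⟩
                           n          ∎) ⟩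
    n / M             ∎)

  n≤t² : ∀ n → N < n → n ≤ t n * t n
  n≤t² n N<n = begin
    n          ≤⟨ ℕₚ.<⇒≤ (m<[1+m/n]*n n M) ⟩
    t n * M    ≤⟨ ℕₚ.*-monoʳ-≤ (t n) (ℕₚ.<⇒≤ (ℕₚ.≤-<-trans M≤Mᴸ (Mᴸ<t n N<n))) ⟩
    t n * t n  ∎
    where
    M≤Mᴸ : M ≤ M ^ L
    M≤Mᴸ = ℕₚ.≤-trans (ℕₚ.≤-reflexive (sym (ℕₚ.^-identityʳ M)))
                      (ℕₚ.^-monoʳ-≤ M (ℕ.>-nonZero⁻¹ L))

  nⁿ≤tˢ : ∀ n → N < n → n ^ n ≤ t n ^ (n + p n)
  nⁿ≤tˢ n N<n = begin
    n ^ n                    ≤⟨ ℕₚ.^-monoˡ-≤ n (ℕₚ.<⇒≤ (m<[1+m/n]*n n M)) ⟩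
    (t n * M) ^ n            ≡⟨ ^-distribʳ-* (t n) M n ⟩
    t n ^ n * M ^ n          ≤⟨ ℕₚ.*-monoʳ-≤ (t n ^ n) (ℕₚ.^-monoʳ-≤ M n≤Lp) ⟩
    t n ^ n * M ^ (L * p n)  ≡⟨ cong (t n ^ n *_) (ℕₚ.^-*-assoc M L (p n)) ⟨
    t n ^ n * (M ^ L) ^ p n  ≤⟨ ℕₚ.*-monoʳ-≤ (t n ^ n) (ℕₚ.^-monoˡ-≤ (p n) (ℕₚ.<⇒≤ (Mᴸ<t n N<n))) ⟩
    t n ^ n * t n ^ p n      ≡⟨ ℕₚ.^-distribˡ-+-* (t n) n (p n) ⟨
    t n ^ (n + p n)          ∎
    where
    n≤Lp : n ≤ L * p n
    n≤Lp = ℕₚ.≤-trans (ℕₚ.<⇒≤ (m<[1+m/n]*n n L)) (ℕₚ.≤-reflexive (ℕₚ.*-comm (p n) L))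

  -- Multiplied by 3 so that L (n / L) ≤ n and M (n / M) ≤ n both apply.
  size : ∀ n → N < n → K * (n + p n + (suc (t n) + (t n + t n))) ≤ (K + 1) * n
  size n N<n = ℕₚ.*-cancelˡ-≤ 3 (begin
    3 * (K * (n + p n + (suc (t n) + (t n + t n))))   ≡⟨ expand K n (n / L) (n / M) ⟩
    3 * K * n + L * (n / L) + M * (n / M) + 15 * K    ≤⟨ ℕₚ.+-mono-≤ (ℕₚ.+-mono-≤ (ℕₚ.+-monoʳ-≤ (3 * K * n)
                                                           (quotient≤ L)) (quotient≤ M)) 15K≤n ⟩
    3 * K * n + n + n + n                             ≡⟨ collect K n ⟩
    3 * ((K + 1) * n)                                 ∎)
    where
    expand : ∀ K n A q → 3 * (K * (n + suc A + (suc (suc q) + (suc q + suc q))))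
                       ≡ 3 * K * n + 3 * K * A + 9 * K * q + 15 * K
    expand = solve-∀
    collect : ∀ K n → 3 * K * n + n + n + n ≡ 3 * ((K + 1) * n)
    collect = solve-∀
    quotient≤ : ∀ d .{{_ : NonZero d}} → d * (n / d) ≤ n
    quotient≤ d = ℕₚ.≤-trans (ℕₚ.≤-reflexive (ℕₚ.*-comm d (n / d))) (ℕₚ.m/n*n≤m n d)
    15K≤n : 15 * K ≤ n
    15K≤n = ℕₚ.≤-trans (ℕₚ.m≤n+m (15 * K) (M ^ suc L)) (ℕₚ.<⇒≤ N<n)

rank1-degree≤ : ∀ {s t} (a : Trans (suc n)) → rank a ≡ 1 →
  0 < s → suc n ^ suc n ≤ t ^ s → suc n ≤ t * t →
  ∃[ d ] IsDegree (suc n) a d × suc n ≤ d × d ≤ s + (suc t + (t + t))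
rank1-degree≤ {s = s} {t} a rank≡1 0<s nⁿ≤tˢ n≤t² = degree-between (ℕₚ.≤-trans 0<s (ℕₚ.m≤m+n s _))
  (ConstantVariant.embedding a (a zero) (λ i → rank≡1⇒constant a rank≡1 i zero) {r = t} 0<s nⁿ≤tˢ n≤t²)

degree-asymptotics : ∀ K .{{_ : NonZero K}} → ∃[ N ] ∀ n → N < n → ∀ (a : Trans n) → rank a ≡ 1 →
  ∃[ d ] IsDegree n a d × n ≤ d × K * d ≤ (K + 1) * n
degree-asymptotics K = let N , sizes = blockSizes K in N , degree sizes
  where
  degree : ∀ {N} → (∀ n → N < n → BlockSizes K n) →
           ∀ n → N < n → ∀ (a : Trans n) → rank a ≡ 1 →
           ∃[ d ] IsDegree n a d × n ≤ d × K * d ≤ (K + 1) * n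
  degree sizes (suc n) N<n a rank≡1 =
    let s , t , 0<s , nⁿ≤tˢ , n≤t² , size≤ = sizes (suc n) N<n
        d , isDegree , n≤d , d≤m = rank1-degree≤ a rank≡1 0<s nⁿ≤tˢ n≤t²
    in d , isDegree , n≤d , ℕₚ.≤-trans (ℕₚ.*-monoʳ-≤ K d≤m) size≤

ℕ→ℚ≡mkℚ : ∀ k → ℕ→ℚ k ≡ mkℚ (+ k) 0 (Coprime.sym (Coprime.1-coprimeTo k))
ℕ→ℚ≡mkℚ k = ℚₚ.↥p/↧p≡p (mkℚ (+ k) 0 (Coprime.sym (Coprime.1-coprimeTo k)))

ℕ→ℚ-mono-≤ : m ≤ n → ℕ→ℚ m ℚ.≤ ℕ→ℚ n
ℕ→ℚ-mono-≤ {m} {n} m≤n rewrite ℕ→ℚ≡mkℚ m | ℕ→ℚ≡mkℚ n =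
  ℚ.*≤* (subst₂ ℤ._≤_ (ℤₚ.pos-* m 1) (ℤₚ.pos-* n 1) (ℤ.+≤+ (ℕₚ.*-monoˡ-≤ 1 m≤n)))

-- The denominator K of x = p / K works: K < p, so K d ≤ (K + 1) n ≤ p n.
1<x⇒[K+1]/K≤x : ∀ x → 1ℚ ℚ.< x →
  ∃[ k ] ∀ d n → suc k * d ≤ (suc k + 1) * n → ℕ→ℚ d ℚ.≤ x ℚ.* ℕ→ℚ n
1<x⇒[K+1]/K≤x (mkℚ -[1+ _ ] _ _) (ℚ.*<* 1<x) = contradiction ℤ.-<+ (ℤₚ.<-asym 1<x)
1<x⇒[K+1]/K≤x x@(mkℚ (+ p) k _) (ℚ.*<* 1<x) = k , λ d n Kd≤[K+1]n →
  subst (λ q → q ℚ.≤ x ℚ.* ℕ→ℚ n) (sym (ℕ→ℚ≡mkℚ d)) (ℚₚ.toℚᵘ-cancel-≤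
    (ℚᵘₚ.≤-respʳ-≃ (ℚᵘₚ.≃-sym (ℚₚ.toℚᵘ-homo-* x (ℕ→ℚ n)))
      (subst (λ q → ℚᵘ.mkℚᵘ (+ d) 0 ℚᵘ.≤ ℚᵘ.mkℚᵘ (+ p) k ℚᵘ.* ℚ.toℚᵘ q) (sym (ℕ→ℚ≡mkℚ n))
        (ℚᵘ.*≤* (cross-multiplied d n Kd≤[K+1]n)))))
  where
  K<p : suc k < p
  K<p = subst₂ _<_ (ℕₚ.*-identityˡ (suc k)) (ℕₚ.*-identityʳ p)
          (ℤₚ.drop‿+<+ (subst₂ ℤ._<_ (sym (ℤₚ.pos-* 1 (suc k))) (sym (ℤₚ.pos-* p 1)) 1<x))
  cross-multiplied : ∀ d n → suc k * d ≤ (suc k + 1) * n →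
                     + d ℤ.* + (suc k * 1) ℤ.≤ (+ p ℤ.* + n) ℤ.* + 1
  cross-multiplied d n Kd≤[K+1]n = subst₂ ℤ._≤_
    (ℤₚ.pos-* d (suc k * 1)) (trans (ℤₚ.pos-* (p * n) 1) (cong (ℤ._* + 1) (ℤₚ.pos-* p n)))
    (ℤ.+≤+ (begin
      d * (suc k * 1)    ≡⟨ trans (cong (d *_) (ℕₚ.*-identityʳ (suc k))) (ℕₚ.*-comm d (suc k)) ⟩
      suc k * d          ≤⟨ Kd≤[K+1]n ⟩
      (suc k + 1) * n    ≤⟨ ℕₚ.*-monoˡ-≤ n (subst (_≤ p) (ℕₚ.+-comm 1 (suc k)) K<p) ⟩
      p * n              ≡⟨ ℕₚ.*-identityʳ (p * n) ⟨
      p * n * 1          ∎))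
    where open ℕₚ.≤-Reasoning

n≤m⇒[1-ε]n≤m : ∀ ε → 0ℚ ℚ.< ε → n ≤ m → (1ℚ - ε) ℚ.* ℕ→ℚ n ℚ.≤ ℕ→ℚ m
n≤m⇒[1-ε]n≤m {n = n} ε 0<ε n≤m = ℚₚ.≤-trans [1-ε]n≤n
  (subst (ℚ._≤ _) (sym (ℚₚ.*-identityˡ (ℕ→ℚ n))) (ℕ→ℚ-mono-≤ n≤m))
  where
  1-ε≤1 : 1ℚ - ε ℚ.≤ 1ℚ
  1-ε≤1 = subst (1ℚ - ε ℚ.≤_) (ℚₚ.+-identityʳ 1ℚ) (ℚₚ.+-monoʳ-≤ 1ℚ (ℚₚ.neg-antimono-≤ (ℚₚ.<⇒≤ 0<ε)))
  [1-ε]n≤n : (1ℚ - ε) ℚ.* ℕ→ℚ n ℚ.≤ 1ℚ ℚ.* ℕ→ℚ n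
  [1-ε]n≤n rewrite ℕ→ℚ≡mkℚ n = ℚₚ.*-monoʳ-≤-nonNeg _ 1-ε≤1

degree≤x*n : ∀ x → 1ℚ ℚ.< x → ∃[ N ] ∀ n → N < n → ∀ (a : Trans n) → rank a ≡ 1 →
  ∃[ d ] IsDegree n a d × n ≤ d × ℕ→ℚ d ℚ.≤ x ℚ.* ℕ→ℚ n
degree≤x*n x 1<x =
  let k , d≤x*n = 1<x⇒[K+1]/K≤x x 1<x
      N , degree = degree-asymptotics (suc k)
  in N , λ n N<n a rank≡1 →
    let d , isDegree , n≤d , Kd≤[K+1]n = degree n N<n a rank≡1
    in d , isDegree , n≤d , d≤x*n d n Kd≤[K+1]n

theorem5p27 :
    (∀ (x : ℚ) → 1ℚ ℚ.< x → x ℚ.< ℕ→ℚ 2 →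
      ∃[ N ] ∀ (n : ℕ) → N ℕ.< n → ∀ (a : Trans n) → rank a ≡ 1 →
        ∃[ d ] IsDegree n a d × ℕ→ℚ d ℚ.≤ x ℚ.* ℕ→ℚ n)
    ×
    (∀ (ε : ℚ) → 0ℚ ℚ.< ε →
      ∃[ N ] ∀ (n : ℕ) → N ℕ.< n → ∀ (a : Trans n) → rank a ≡ 1 →
        ∃[ d ] IsDegree n a d
          × (1ℚ - ε) ℚ.* ℕ→ℚ n ℚ.≤ ℕ→ℚ d
          × ℕ→ℚ d ℚ.≤ (1ℚ ℚ.+ ε) ℚ.* ℕ→ℚ n)
theorem5p27 =
  (λ x 1<x _ →
    let N , degree = degree≤x*n x 1<x
    in N , λ n N<n a rank≡1 →
      let d , isDegree , _ , d≤xn = degree n N<n a rank≡1 in d , isDegree , d≤xn) ,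
  (λ ε 0<ε →
    let N , degree = degree≤x*n (1ℚ ℚ.+ ε) (1<1+ε ε 0<ε)
    in N , λ n N<n a rank≡1 →
      let d , isDegree , n≤d , d≤[1+ε]n = degree n N<n a rank≡1
      in d , isDegree , n≤m⇒[1-ε]n≤m ε 0<ε n≤d , d≤[1+ε]n)
  where
  1<1+ε : ∀ ε → 0ℚ ℚ.< ε → 1ℚ ℚ.< 1ℚ ℚ.+ ε
  1<1+ε ε 0<ε = subst (ℚ._< 1ℚ ℚ.+ ε) (ℚₚ.+-identityʳ 1ℚ) (ℚₚ.+-monoʳ-< 1ℚ 0<ε)
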